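{- Let $\Gamma$ be a phylogenetic CSP with a satisfiable payoff function $f$ of arity $k$. For every gap instance $\mathcal{I}^f_{gap}$ of arbitrary size, $\mathrm{opt}(\mathcal{I}^f_{gap})=1$.
   Context: Trees: a tree is a finite rooted tree in which every internal node has exactly two children ordered as left and right; leaves are ordered left to right. A pattern on $x_1,\dots,x_k$ is such a tree with $k$ leaves bijectively labelled by $x_1,\dots,x_k$. Distinct variables injectively placed at leaves of a tree match pattern $P$ if $P$ is obtained by repeatedly deleting unassigned leaves and contracting nodes with one child (preserving labels and order). A phylogenetic payoff function $f$ of arity $k$ assigns a payoff in $[0,1]$ to each pattern; $f(y_1,\dots,y_k)$ is the payoff of the pattern matched by $y_1,\dots,y_k$ (the $i$-th argument playing the role of $x_i$). $f$ is satisfiable if its maximum payoff is $1$. An instance: finite variable set $V$ with a probability distribution over constraints $f(y_1,\dots,y_k)$ on distinct variables; a solution injectively maps $V$ to leaves of a tree; its value is the expected payoff of a random constraint; $\mathrm{opt}$ is the maximum value. Gap instance: for $d\ge1$, $T$ is a perfect ordered $k$-ary tree of depth $d$. A random $k$-tuple of leaves: pick $t$ uniformly in $\{0,\dots,d-1\}$, a uniformly random node $u$ at depth $t$ with children $u_1,\dots,u_k$ left to right, and independently $l_j$ uniform among leaves under $u_j$. $\mathcal{I}^f_{gap}$ has the leaves of $T$ as variables and constraint $f(a_1,\dots,a_k)$ with weight $\Pr[(l_1,\dots,l_k)=(a_1,\dots,a_k)]$.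
   Formalization: The payoff function f takes rational values in $[0,1]$ rather than real ones. -}

module Defs where

open import Data.Nat as ℕ using (ℕ; zero; suc; _∸_; _<_; NonZero)
import Data.Nat.Properties as ℕP
open import Data.Integer using (+_)
open import Data.Rational using (ℚ; 0ℚ; 1ℚ; _+_; _*_; _≤_; _/_)
open import Data.Fin as Fin using (Fin; toℕ)
open import Data.Fin.Properties using (toℕ<n)
open import Data.Vec as Vec using (Vec; []; _∷_; _++_; cast)
open import Data.List as List using (List; []; _∷_; concatMap; allFin)
open import Data.List.Relation.Binary.Permutation.Propositional using (_↭_)
open import Data.Maybe as Maybe using (Maybe; just; nothing; maybe)
open import Data.Bool using (Bool; if_then_else_)
open import Data.Product using (Σ; _×_; _,_; ∃)
open import Relation.Nullary using (Dec; yes; no; ⌊_⌋)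
open import Relation.Binary.PropositionalEquality using (_≡_; refl; cong; trans; sym)
open import Function.Definitions using (Injective)

data Tree : Set where
  leaf : Tree
  node : Tree → Tree → Tree

data Leaf : Tree → Set where
  here : Leaf leaf
  goL  : ∀ {l r} → Leaf l → Leaf (node l r)
  goR  : ∀ {l r} → Leaf r → Leaf (node l r)

_≟L_ : ∀ {T} (p q : Leaf T) → Dec (p ≡ q)
here  ≟L here  = yes refl
goL p ≟L goL q with p ≟L q
... | yes refl = yes refl
... | no ne = no λ { refl → ne refl }
goL p ≟L goR q = no λ ()
goR p ≟L goL q = no λ ()
goR p ≟L goR q with p ≟L q
... | yes refl = yes refl
... | no ne = no λ { refl → ne refl }

data LTree (A : Set) : Set where
  lf : A → LTree A
  nd : LTree A → LTree A → LTree A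

leafLabels : ∀ {A} → LTree A → List A
leafLabels (lf a)   = a ∷ []
leafLabels (nd l r) = leafLabels l List.++ leafLabels r

-- P is a pattern on x_1..x_k: its leaves are labelled bijectively by Fin k
IsPattern : (k : ℕ) → LTree (Fin k) → Set
IsPattern k P = leafLabels P ↭ allFin k

-- delete unassigned leaves (label nothing) and contract unary nodes
prune : ∀ {A} (T : Tree) → (Leaf T → Maybe A) → Maybe (LTree A)
prune leaf lab = Maybe.map lf (lab here)
prune (node l r) lab with prune l (λ p → lab (goL p)) | prune r (λ p → lab (goR p))
... | just L  | just R  = just (nd L R)
... | just L  | nothing = just L
... | nothing | just R  = just R
... | nothing | nothing = nothing

search : ∀ {k} → (Fin k → Bool) → Maybe (Fin k)
search {zero}  P = nothing
search {suc k} P = if P Fin.zero then just Fin.zero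
                   else Maybe.map Fin.suc (search (λ i → P (Fin.suc i)))

-- Phylogenetic payoff functions of arity k.  Only the values on
-- patterns (IsPattern) are meaningful.

PayoffFn : ℕ → Set
PayoffFn k = LTree (Fin k) → ℚ

IsPayoff : ∀ {k} → PayoffFn k → Set
IsPayoff {k} f = ∀ P → IsPattern k P → (0ℚ ≤ f P) × (f P ≤ 1ℚ)

-- maximum payoff is 1 (payoffs are ≤ 1, so: some pattern has payoff 1)
Satisfiable : ∀ {k} → PayoffFn k → Set
Satisfiable {k} f = Σ (LTree (Fin k)) λ P → IsPattern k P × (f P ≡ 1ℚ)

Solution : Set → Set
Solution V = Σ Tree λ T → Σ (V → Leaf T) λ σ → Injective _≡_ _≡_ σ

matched : ∀ {V k} → Solution V → (Fin k → V) → Maybe (LTree (Fin k))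
matched (T , σ , _) y = prune T (λ p → search (λ i → ⌊ σ (y i) ≟L p ⌋))

payoff : ∀ {V k} → PayoffFn k → Solution V → (Fin k → V) → ℚ
payoff f sol y = maybe f 0ℚ (matched sol y)

Instance : Set → ℕ → Set
Instance V k = List (ℚ × (Fin k → V))

sumℚ : List ℚ → ℚ
sumℚ = List.foldr _+_ 0ℚ

value : ∀ {V k} → PayoffFn k → Instance V k → Solution V → ℚ
value f I sol = sumℚ (List.map (λ { (w , y) → w * payoff f sol y }) I)

OptIs : ∀ {V k} → PayoffFn k → Instance V k → ℚ → Set
OptIs {V} f I v = (Σ (Solution V) λ sol → value f I sol ≡ v)
                × (∀ (sol : Solution V) → value f I sol ≤ v)

-- Gap instance.  Leaves of the perfect ordered k-ary tree of depth d
-- are the root-to-leaf paths Vec (Fin k) d.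

allVecs : (k n : ℕ) → List (Vec (Fin k) n)
allVecs k zero    = [] ∷ []
allVecs k (suc n) = concatMap (λ c → List.map (c ∷_) (allVecs k n)) (allFin k)

allFuns : ∀ {A : Set} (m : ℕ) → List A → List (Fin m → A)
allFuns zero    xs = (λ ()) ∷ []
allFuns (suc m) xs =
  concatMap (λ a → List.map (λ g → λ { Fin.zero → a ; (Fin.suc i) → g i }) (allFuns m xs)) xs

len-lemma : ∀ t d → t < d → t ℕ.+ suc (d ∸ suc t) ≡ d
len-lemma t d t<d = trans (ℕP.+-suc t (d ∸ suc t)) (ℕP.m+[n∸m]≡n t<d)

-- weight 1 / (d · k^t · (k^(d-t-1))^k): t uniform in {0..d-1}, u uniform
-- among k^t nodes at depth t, each l_j uniform among k^(d-t-1) leaves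
weight : (k d t : ℕ) → .{{NonZero k}} → .{{NonZero d}} → ℚ
weight k d t {{nzk}} {{nzd}} = _/_ (+ 1) (d ℕ.* (k ℕ.^ t ℕ.* ((k ℕ.^ (d ∸ suc t)) ℕ.^ k)))
  {{ℕP.m*n≢0 d _ {{nzd}} {{ℕP.m*n≢0 (k ℕ.^ t) _ {{ℕP.m^n≢0 k t}}
      {{ℕP.m^n≢0 (k ℕ.^ (d ∸ suc t)) k {{ℕP.m^n≢0 k (d ∸ suc t)}}}}}}}}

gapInstance : (k d : ℕ) → .{{NonZero k}} → .{{NonZero d}} → Instance (Vec (Fin k) d) k
gapInstance k d = concatMap level (allFin d)
  where
  level : Fin d → Instance (Vec (Fin k) d) k
  level t = concatMap (λ u → List.map (λ s → weight k d (toℕ t) ,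
                 (λ j → cast (len-lemma (toℕ t) d (toℕ<n t)) (u ++ (j ∷ s j))))
               (allFuns k (allVecs k (d ∸ suc (toℕ t)))))
            (allVecs k (toℕ t))

-- Let P be a pattern with f(P) = 1, and let T_d be the tree obtained from a single leaf by
-- substituting P for every leaf, d times over.  A word v of length d over the labels of P picks a
-- leaf of T_d letter by letter (the i-th letter names a leaf of the i-th copy of P on the way
-- down), which identifies the leaves of the perfect k-ary tree of depth d with leaves of T_d.  A
-- constraint of the gap instance at depth t takes a common prefix u of length t followed by k
-- branches starting with the k different letters; these k leaves lie in the k subtrees hanging
-- from one copy of P, so after pruning they match P and the constraint pays 1.  As the weights
-- form a probability distribution and every payoff is at most 1, the value 1 is optimal.
{-# OPTIONS --safe #-}
module Submission where

open import Defs
open import Data.Nat using (ℕ; NonZero)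
open import Data.Rational using (1ℚ)

open import Data.Bool using (Bool; true; false)
open import Data.Bool.Properties using (T-≡)
open import Data.Empty using (⊥-elim)
open import Data.Fin as Fin using (Fin; toℕ)
open import Data.Fin.Properties using (toℕ<n; 0≢1+n; suc-injective)
open import Data.Integer as ℤ using (+_)
import Data.Integer.Properties as ℤP
open import Data.List as List using (List; []; _∷_; _++_; [_]; allFin; concatMap; length)
import Data.List.Properties as ListP
open import Data.List.Membership.Propositional using (_∈_)
open import Data.List.Membership.Propositional.Properties using (∈-++⁻; ∈-++⁺ˡ; ∈-++⁺ʳ; ∈-allFin)
open import Data.List.Membership.Propositional.Properties.WithK using (unique∧set⇒bag)
open import Data.List.Relation.Binary.BagAndSetEquality using (∼bag⇒↭)
open import Data.List.Relation.Binary.Disjoint.Propositional using (Disjoint)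
open import Data.List.Relation.Binary.Permutation.Propositional using (_↭_; ↭-sym; ↭⇒↭ₛ)
open import Data.List.Relation.Binary.Permutation.Propositional.Properties using (∈-resp-↭)
import Data.List.Relation.Binary.Permutation.Setoid.Properties as PermutationₛP
open import Data.List.Relation.Unary.All as All using (All; []; _∷_)
import Data.List.Relation.Unary.All.Properties as AllP
open import Data.List.Relation.Unary.Any using (here; there)
open import Data.List.Relation.Unary.Unique.Propositional using (Unique; []; _∷_)
import Data.List.Relation.Unary.Unique.Propositional.Properties as UniqueP
open import Data.Maybe as Maybe using (Maybe; just; nothing; maybe)
import Data.Nat as ℕ
open import Data.Nat using (zero; suc; _∸_)
import Data.Nat.Properties as ℕP
open import Data.Nat.Solver using (module +-*-Solver)
open import Data.Product using (_×_; _,_; proj₁; proj₂; ∃)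
open import Data.Rational using (ℚ; 0ℚ; _+_; _*_; _≤_; _/_; toℚᵘ; nonNegative; +-0-rawMonoid)
import Data.Rational.Properties as ℚP
import Data.Rational.Unnormalised as ℚᵘ
import Data.Rational.Unnormalised.Properties as ℚᵘP
open import Data.Sum using (inj₁; inj₂)
open import Data.Vec as Vec using (Vec; []; _∷_; cast)
import Data.Vec.Properties as VecP
open import Function.Base using (_∘_)
open import Function.Bundles using (mk⇔; Equivalence)
open import Function.Definitions using (Injective)
open import Relation.Binary.PropositionalEquality
  using (_≡_; _≢_; refl; sym; trans; cong; cong₂; subst; setoid; module ≡-Reasoning)
open import Relation.Nullary using (yes; no; ⌊_⌋)
open import Relation.Nullary.Decidable using (toWitness; isYes≗does; dec-true; dec-false)

open import Algebra.Definitions.RawMonoid +-0-rawMonoid using () renaming (_×_ to _·_)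

-- Labels and pruning

search-nothing : ∀ {k} (P : Fin k → Bool) → (∀ i → P i ≡ false) → search P ≡ nothing
search-nothing {zero}  P never = refl
search-nothing {suc k} P never rewrite never Fin.zero =
  cong (Maybe.map Fin.suc) (search-nothing (P ∘ Fin.suc) (never ∘ Fin.suc))

search-just : ∀ {k} (P : Fin k → Bool) {c} → P c ≡ true → (∀ i → P i ≡ true → i ≡ c) → search P ≡ just c
search-just {suc k} P {Fin.zero}  Pc only rewrite Pc = refl
search-just {suc k} P {Fin.suc c} Pc only with P Fin.zero in P0
... | true  = ⊥-elim (0≢1+n (only Fin.zero P0))
... | false = cong (Maybe.map Fin.suc)
                   (search-just (P ∘ Fin.suc) Pc (λ i Pi → suc-injective (only (Fin.suc i) Pi)))

search-sound : ∀ {k} (P : Fin k → Bool) {c} → search P ≡ just c → P c ≡ true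
search-sound {suc k} P {c} found with P Fin.zero in P0
search-sound {suc k} P {Fin.zero} refl | true = P0
... | false with search (P ∘ Fin.suc) in found′
search-sound {suc k} P {Fin.suc c} refl | false | just c = search-sound (P ∘ Fin.suc) found′

search-cong : ∀ {k} (P Q : Fin k → Bool) → (∀ i → P i ≡ Q i) → search P ≡ search Q
search-cong {zero}  P Q P≗Q = refl
search-cong {suc k} P Q P≗Q
  rewrite P≗Q Fin.zero | search-cong (P ∘ Fin.suc) (Q ∘ Fin.suc) (P≗Q ∘ Fin.suc) = refl

goL-injective : ∀ {l r} {p q : Leaf l} → goL {r = r} p ≡ goL q → p ≡ q
goL-injective refl = refl

goR-injective : ∀ {l r} {p q : Leaf r} → goR {l = l} p ≡ goR q → p ≡ q
goR-injective refl = refl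

≟L-true : ∀ {T} {p q : Leaf T} → p ≡ q → ⌊ p ≟L q ⌋ ≡ true
≟L-true {p = p} {q} p≡q = trans (isYes≗does (p ≟L q)) (dec-true (p ≟L q) p≡q)

≟L-false : ∀ {T} {p q : Leaf T} → p ≢ q → ⌊ p ≟L q ⌋ ≡ false
≟L-false {p = p} {q} p≢q = trans (isYes≗does (p ≟L q)) (dec-false (p ≟L q) p≢q)

≟L-sound : ∀ {T} {p q : Leaf T} → ⌊ p ≟L q ⌋ ≡ true → p ≡ q
≟L-sound p≟q = toWitness (Equivalence.from T-≡ p≟q)

≟L-map : ∀ {S T} {g : Leaf S → Leaf T} → Injective _≡_ _≡_ g → ∀ p q → ⌊ g p ≟L g q ⌋ ≡ ⌊ p ≟L q ⌋
≟L-map {g = g} g-inj p q with p ≟L q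
... | yes p≡q = ≟L-true (cong g p≡q)
... | no  p≢q = ≟L-false (p≢q ∘ g-inj)

-- matched (T , σ , _) y unfolds to prune T (labOf (σ ∘ y)).
labOf : ∀ {k T} → (Fin k → Leaf T) → Leaf T → Maybe (Fin k)
labOf L p = search (λ i → ⌊ L i ≟L p ⌋)

module _ {k T} (L : Fin k → Leaf T) where

  labOf-nothing : ∀ {p} → (∀ i → L i ≢ p) → labOf L p ≡ nothing
  labOf-nothing L≢p = search-nothing _ (≟L-false ∘ L≢p)

  labOf-just : ∀ {p c} → L c ≡ p → (∀ i → L i ≡ p → i ≡ c) → labOf L p ≡ just c
  labOf-just Lc≡p only = search-just _ (≟L-true Lc≡p) (λ i → only i ∘ ≟L-sound)

  labOf-sound : ∀ {p c} → labOf L p ≡ just c → L c ≡ p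
  labOf-sound = ≟L-sound ∘ search-sound _

  labOf-cong : ∀ {L′} → (∀ i → L i ≡ L′ i) → ∀ p → labOf L p ≡ labOf L′ p
  labOf-cong L≗L′ p = search-cong _ _ (λ i → cong (λ q → ⌊ q ≟L p ⌋) (L≗L′ i))

  labOf-map : ∀ {S} {g : Leaf T → Leaf S} → Injective _≡_ _≡_ g → ∀ p → labOf (g ∘ L) (g p) ≡ labOf L p
  labOf-map g-inj p = search-cong _ _ (λ i → ≟L-map g-inj (L i) p)

module _ {A : Set} where

  prune-cong : ∀ T (lab lab′ : Leaf T → Maybe A) → (∀ p → lab p ≡ lab′ p) → prune T lab ≡ prune T lab′
  prune-cong leaf       lab lab′ lab≗lab′ rewrite lab≗lab′ here = refl
  prune-cong (node l r) lab lab′ lab≗lab′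
    rewrite prune-cong l (lab ∘ goL) (lab′ ∘ goL) (lab≗lab′ ∘ goL)
          | prune-cong r (lab ∘ goR) (lab′ ∘ goR) (lab≗lab′ ∘ goR) = refl

  prune-nodeˡ : ∀ l r (lab : Leaf (node l r) → Maybe A) →
                prune r (lab ∘ goR) ≡ nothing → prune (node l r) lab ≡ prune l (lab ∘ goL)
  prune-nodeˡ l r lab empty with prune l (lab ∘ goL) | prune r (lab ∘ goR)
  ... | just _  | nothing = refl
  ... | nothing | nothing = refl
  prune-nodeˡ l r lab () | _ | just _

  prune-nodeʳ : ∀ l r (lab : Leaf (node l r) → Maybe A) →
                prune l (lab ∘ goL) ≡ nothing → prune (node l r) lab ≡ prune r (lab ∘ goR)
  prune-nodeʳ l r lab empty with prune l (lab ∘ goL) | prune r (lab ∘ goR)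
  ... | nothing | just _  = refl
  ... | nothing | nothing = refl
  prune-nodeʳ l r lab () | just _ | _

  prune-nothing : ∀ T (lab : Leaf T → Maybe A) → (∀ p → lab p ≡ nothing) → prune T lab ≡ nothing
  prune-nothing leaf       lab unlabelled rewrite unlabelled here = refl
  prune-nothing (node l r) lab unlabelled = trans
    (prune-nodeˡ l r lab (prune-nothing r (lab ∘ goR) (unlabelled ∘ goR)))
    (prune-nothing l (lab ∘ goL) (unlabelled ∘ goL))

  prune-single : ∀ T (lab : Leaf T → Maybe A) (q : Leaf T) {c} → lab q ≡ just c →
                 (∀ p → p ≢ q → lab p ≡ nothing) → prune T lab ≡ just (lf c)
  prune-single leaf lab here labq _ rewrite labq = refl
  prune-single (node l r) lab (goL q) labq others = trans
    (prune-nodeˡ l r lab (prune-nothing r (lab ∘ goR) (λ p → others (goR p) λ ())))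
    (prune-single l (lab ∘ goL) q labq (λ p p≢q → others (goL p) (p≢q ∘ goL-injective)))
  prune-single (node l r) lab (goR q) labq others = trans
    (prune-nodeʳ l r lab (prune-nothing l (lab ∘ goL) (λ p → others (goL p) λ ())))
    (prune-single r (lab ∘ goR) q labq (λ p p≢q → others (goR p) (p≢q ∘ goR-injective)))

-- Grafting

data Occ {A : Set} : LTree A → A → Set where
  occ-lf  : ∀ c → Occ (lf c) c
  occ-ndˡ : ∀ {L R c} → Occ L c → Occ (nd L R) c
  occ-ndʳ : ∀ {L R c} → Occ R c → Occ (nd L R) c

graft : ∀ {A} → LTree A → Tree → Tree
graft (lf _)   S = S
graft (nd L R) S = node (graft L S) (graft R S)

graftLeaf : ∀ {A} {P : LTree A} {c S} → Occ P c → Leaf S → Leaf (graft P S)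
graftLeaf (occ-lf _)  q = q
graftLeaf (occ-ndˡ o) q = goL (graftLeaf o q)
graftLeaf (occ-ndʳ o) q = goR (graftLeaf o q)

graftLeaf-injective : ∀ {A} {P : LTree A} {c c′ S} (o : Occ P c) (o′ : Occ P c′) {q q′ : Leaf S} →
                      graftLeaf o q ≡ graftLeaf o′ q′ → c ≡ c′ × q ≡ q′
graftLeaf-injective (occ-lf _)  (occ-lf _)   q≡q′ = refl , q≡q′
graftLeaf-injective (occ-ndˡ o) (occ-ndˡ o′) eq   = graftLeaf-injective o o′ (goL-injective eq)
graftLeaf-injective (occ-ndʳ o) (occ-ndʳ o′) eq   = graftLeaf-injective o o′ (goR-injective eq)

module _ {A : Set} where

  prune-graft : ∀ (P : LTree A) S (lab : Leaf (graft P S) → Maybe A) →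
                (∀ {c} (o : Occ P c) → prune S (lab ∘ graftLeaf o) ≡ just (lf c)) →
                prune (graft P S) lab ≡ just P
  prune-graft (lf c)   S lab copies = copies (occ-lf c)
  prune-graft (nd L R) S lab copies
    rewrite prune-graft L S (lab ∘ goL) (copies ∘ occ-ndˡ)
          | prune-graft R S (lab ∘ goR) (copies ∘ occ-ndʳ) = refl

  prune-graft-copy : ∀ {B} (P : LTree B) S (lab : Leaf (graft P S) → Maybe A) {c} (o : Occ P c) →
                     (∀ p → (∀ q → graftLeaf o q ≢ p) → lab p ≡ nothing) →
                     prune (graft P S) lab ≡ prune S (lab ∘ graftLeaf o)
  prune-graft-copy (lf _)   S lab (occ-lf _)  outside = refl
  prune-graft-copy (nd L R) S lab (occ-ndˡ o) outside = trans
    (prune-nodeˡ _ _ lab (prune-nothing _ (lab ∘ goR) (λ p → outside (goR p) λ _ ())))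
    (prune-graft-copy L S (lab ∘ goL) o (λ p notIn → outside (goL p) (λ q → notIn q ∘ goL-injective)))
  prune-graft-copy (nd L R) S lab (occ-ndʳ o) outside = trans
    (prune-nodeʳ _ _ lab (prune-nothing _ (lab ∘ goL) (λ p → outside (goL p) λ _ ())))
    (prune-graft-copy R S (lab ∘ goR) o (λ p notIn → outside (goR p) (λ q → notIn q ∘ goR-injective)))

prune-graft-labOf : ∀ {k B} (P : LTree B) S {c} (o : Occ P c) (L : Fin k → Leaf S) →
                    prune (graft P S) (labOf (graftLeaf o ∘ L)) ≡ prune S (labOf L)
prune-graft-labOf P S o L = trans
  (prune-graft-copy P S _ o (λ p notIn → labOf-nothing _ (λ i → notIn (L i))))
  (prune-cong S _ _ (labOf-map L (proj₂ ∘ graftLeaf-injective o o)))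

-- Patterns

Unique-++⁻ : ∀ {A : Set} (xs : List A) {ys} → Unique (xs ++ ys) → Unique xs × Unique ys × Disjoint xs ys
Unique-++⁻ []       u        = [] , u , λ { (() , _) }
Unique-++⁻ (x ∷ xs) (x∉ ∷ u) with Unique-++⁻ xs u
... | uxs , uys , disjoint = AllP.++⁻ˡ xs x∉ ∷ uxs , uys , λ
  { (here refl , x∈ys)  → All.lookup (AllP.++⁻ʳ xs x∉) x∈ys refl
  ; (there v∈xs , v∈ys) → disjoint (v∈xs , v∈ys) }

module _ {A : Set} where

  Occ⇒∈ : ∀ {P : LTree A} {c} → Occ P c → c ∈ leafLabels P
  Occ⇒∈          (occ-lf _)  = here refl
  Occ⇒∈          (occ-ndˡ o) = ∈-++⁺ˡ (Occ⇒∈ o)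
  Occ⇒∈ {nd L R} (occ-ndʳ o) = ∈-++⁺ʳ (leafLabels L) (Occ⇒∈ o)

  ∈⇒Occ : ∀ (P : LTree A) {c} → c ∈ leafLabels P → Occ P c
  ∈⇒Occ (lf c)   (here refl) = occ-lf c
  ∈⇒Occ (nd L R) c∈ with ∈-++⁻ (leafLabels L) c∈
  ... | inj₁ c∈L = occ-ndˡ (∈⇒Occ L c∈L)
  ... | inj₂ c∈R = occ-ndʳ (∈⇒Occ R c∈R)

  Occ-unique : ∀ (P : LTree A) → Unique (leafLabels P) → ∀ {c} (o o′ : Occ P c) → o ≡ o′
  Occ-unique (lf c)   _ (occ-lf _)  (occ-lf _) = refl
  Occ-unique (nd L R) u o o′ with Unique-++⁻ (leafLabels L) u
  Occ-unique (nd L R) u (occ-ndˡ o) (occ-ndˡ o′) | uL , _  , _ = cong occ-ndˡ (Occ-unique L uL o o′)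
  Occ-unique (nd L R) u (occ-ndʳ o) (occ-ndʳ o′) | _  , uR , _ = cong occ-ndʳ (Occ-unique R uR o o′)
  Occ-unique (nd L R) u (occ-ndˡ o) (occ-ndʳ o′) | _  , _  , disjoint = ⊥-elim (disjoint (Occ⇒∈ o , Occ⇒∈ o′))
  Occ-unique (nd L R) u (occ-ndʳ o) (occ-ndˡ o′) | _  , _  , disjoint = ⊥-elim (disjoint (Occ⇒∈ o′ , Occ⇒∈ o))

module _ {k} {P : LTree (Fin k)} (isP : IsPattern k P) where

  pattern-Occ : ∀ c → Occ P c
  pattern-Occ c = ∈⇒Occ P (∈-resp-↭ (↭-sym isP) (∈-allFin c))

  pattern-Occ-unique : ∀ {c} (o o′ : Occ P c) → o ≡ o′
  pattern-Occ-unique = Occ-unique P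
    (PermutationₛP.Unique-resp-↭ (setoid (Fin k)) (↭⇒↭ₛ (↭-sym isP)) (UniqueP.allFin⁺ k))

module _ {A : Set} where

  readLabels : ∀ T → (Leaf T → Maybe A) → List A
  readLabels leaf       lab = maybe [_] [] (lab here)
  readLabels (node l r) lab = readLabels l (lab ∘ goL) ++ readLabels r (lab ∘ goR)

  leafLabels-prune : ∀ T (lab : Leaf T → Maybe A) → maybe leafLabels [] (prune T lab) ≡ readLabels T lab
  leafLabels-prune leaf lab with lab here
  ... | just _  = refl
  ... | nothing = refl
  leafLabels-prune (node l r) lab
    with prune l (lab ∘ goL) | leafLabels-prune l (lab ∘ goL)
       | prune r (lab ∘ goR) | leafLabels-prune r (lab ∘ goR)
  ... | just _  | ihˡ | just _  | ihʳ = cong₂ _++_ ihˡ ihʳ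
  ... | just L  | ihˡ | nothing | ihʳ = trans (sym (ListP.++-identityʳ (leafLabels L))) (cong₂ _++_ ihˡ ihʳ)
  ... | nothing | ihˡ | just _  | ihʳ = cong₂ _++_ ihˡ ihʳ
  ... | nothing | ihˡ | nothing | ihʳ = cong₂ _++_ ihˡ ihʳ

  ∈-readLabels⁻ : ∀ T (lab : Leaf T → Maybe A) {i} → i ∈ readLabels T lab → ∃ λ p → lab p ≡ just i
  ∈-readLabels⁻ leaf lab i∈ with lab here in labHere
  ∈-readLabels⁻ leaf lab (here refl) | just _ = here , labHere
  ∈-readLabels⁻ (node l r) lab i∈ with ∈-++⁻ (readLabels l (lab ∘ goL)) i∈
  ... | inj₁ i∈l = let p , labp = ∈-readLabels⁻ l (lab ∘ goL) i∈l in goL p , labp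
  ... | inj₂ i∈r = let p , labp = ∈-readLabels⁻ r (lab ∘ goR) i∈r in goR p , labp

  ∈-readLabels⁺ : ∀ T (lab : Leaf T → Maybe A) {i} p → lab p ≡ just i → i ∈ readLabels T lab
  ∈-readLabels⁺ leaf       lab here    labp rewrite labp = here refl
  ∈-readLabels⁺ (node l r) lab (goL p) labp = ∈-++⁺ˡ (∈-readLabels⁺ l (lab ∘ goL) p labp)
  ∈-readLabels⁺ (node l r) lab (goR p) labp =
    ∈-++⁺ʳ (readLabels l (lab ∘ goL)) (∈-readLabels⁺ r (lab ∘ goR) p labp)

  readLabels-unique : ∀ T (lab : Leaf T → Maybe A) →
                      (∀ p q {i} → lab p ≡ just i → lab q ≡ just i → p ≡ q) → Unique (readLabels T lab)
  readLabels-unique leaf lab _ with lab here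
  ... | just _  = [] ∷ []
  ... | nothing = []
  readLabels-unique (node l r) lab lab-inj = UniqueP.++⁺
    (readLabels-unique l (lab ∘ goL) (λ p q labp labq → goL-injective (lab-inj _ _ labp labq)))
    (readLabels-unique r (lab ∘ goR) (λ p q labp labq → goR-injective (lab-inj _ _ labp labq)))
    disjoint
    where
    disjoint : Disjoint (readLabels l (lab ∘ goL)) (readLabels r (lab ∘ goR))
    disjoint (i∈l , i∈r) with ∈-readLabels⁻ l _ i∈l | ∈-readLabels⁻ r _ i∈r
    ... | p , labp | q , labq with () ← lab-inj _ _ labp labq

readLabels-labOf-↭ : ∀ {k T} (L : Fin k → Leaf T) → Injective _≡_ _≡_ L → readLabels T (labOf L) ↭ allFin k
readLabels-labOf-↭ {k} {T} L L-inj = ∼bag⇒↭ (unique∧set⇒bag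
  (readLabels-unique T (labOf L) (λ p q labp labq → trans (sym (labOf-sound L labp)) (labOf-sound L labq)))
  (UniqueP.allFin⁺ k)
  (λ {i} → mk⇔ (λ _ → ∈-allFin i) (λ _ → ∈-readLabels⁺ T (labOf L) (L i) (labOf-just L refl (λ _ → L-inj)))))

prune-labOf-isPattern : ∀ {k T} (L : Fin k → Leaf T) → Injective _≡_ _≡_ L →
                        ∀ {Q} → prune T (labOf L) ≡ just Q → IsPattern k Q
prune-labOf-isPattern {k} {T} L L-inj pruned =
  subst (_↭ allFin k) (trans (sym (leafLabels-prune T (labOf L))) (cong (maybe leafLabels []) pruned))
        (readLabels-labOf-↭ L L-inj)

payoff≤1 : ∀ {V k} (f : PayoffFn k) → IsPayoff f → (sol : Solution V) {y : Fin k → V} →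
           Injective _≡_ _≡_ y → payoff f sol y ≤ 1ℚ
payoff≤1 f isPayoff sol@(T , σ , σ-inj) {y} y-inj with matched sol y in matchedQ
... | just Q  = proj₂ (isPayoff Q (prune-labOf-isPattern (σ ∘ y) (y-inj ∘ σ-inj) matchedQ))
... | nothing = ℚP.nonNegative⁻¹ 1ℚ

-- Iterated grafting

module GraftPower {k} (P : LTree (Fin k)) (isP : IsPattern k P) where

  graftPower : ℕ → Tree
  graftPower zero    = leaf
  graftPower (suc n) = graft P (graftPower n)

  embed : ∀ {n} → Vec (Fin k) n → Leaf (graftPower n)
  embed []      = here
  embed (c ∷ v) = graftLeaf (pattern-Occ isP c) (embed v)

  embed-injective : ∀ {n} → Injective _≡_ _≡_ (embed {n})
  embed-injective {x = []}    {[]}     _  = refl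
  embed-injective {x = c ∷ v} {c′ ∷ w} eq with graftLeaf-injective (pattern-Occ isP c) (pattern-Occ isP c′) eq
  ... | refl , eq′ = cong (c ∷_) (embed-injective eq′)

  -- The copy of S at the leaf of P labelled c contains exactly one labelled leaf, L c, labelled c.
  prune-graft-spread : ∀ S (L : Fin k → Leaf S) →
                       prune (graft P S) (labOf (λ j → graftLeaf (pattern-Occ isP j) (L j))) ≡ just P
  prune-graft-spread S L = prune-graft P S _ copy
    where
    M : Fin k → Leaf (graft P S)
    M j = graftLeaf (pattern-Occ isP j) (L j)

    elsewhere : ∀ {c} p → p ≢ L c → ∀ i → M i ≢ graftLeaf (pattern-Occ isP c) p
    elsewhere {c} p p≢Lc i eq with graftLeaf-injective (pattern-Occ isP i) (pattern-Occ isP c) {L i} {p} eq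
    ... | refl , refl = p≢Lc refl

    copy : ∀ {c} (o : Occ P c) → prune S (labOf M ∘ graftLeaf o) ≡ just (lf c)
    copy {c} o with pattern-Occ-unique isP (pattern-Occ isP c) o
    ... | refl = prune-single S _ (L c)
                   (labOf-just M refl (λ i → proj₁ ∘ graftLeaf-injective (pattern-Occ isP i) o))
                   (λ p p≢Lc → labOf-nothing M (elsewhere p p≢Lc))

  prune-branch : ∀ {t m} (u : Vec (Fin k) t) (s : Fin k → Vec (Fin k) m) →
                 prune (graftPower (t ℕ.+ suc m)) (labOf (λ j → embed (u Vec.++ j ∷ s j))) ≡ just P
  prune-branch []      s = prune-graft-spread _ (embed ∘ s)
  prune-branch (c ∷ u) s = trans
    (prune-graft-labOf P _ (pattern-Occ isP c) (λ j → embed (u Vec.++ j ∷ s j)))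
    (prune-branch u s)

  prune-embed-cast : ∀ {n n′} (eq : n ≡ n′) (w : Fin k → Vec (Fin k) n) →
                     prune (graftPower n′) (labOf (λ j → embed (cast eq (w j)))) ≡
                     prune (graftPower n) (labOf (embed ∘ w))
  prune-embed-cast refl w = prune-cong _ _ _ (labOf-cong _ (λ i → cong embed (VecP.cast-is-id refl (w i))))

-- Weights

/-cross : ∀ a b m n .{{_ : NonZero m}} .{{_ : NonZero n}} → a ℕ.* n ≡ b ℕ.* m → + a / m ≡ + b / n
/-cross a b m@(suc m-1) n@(suc n-1) eq =
  ℚP.fromℚᵘ-cong {ℚᵘ.mkℚᵘ (+ a) m-1} {ℚᵘ.mkℚᵘ (+ b) n-1} (ℚᵘ.*≡* (begin
    + a ℤ.* + n  ≡⟨ ℤP.pos-* a n ⟨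
    + (a ℕ.* n)  ≡⟨ cong +_ eq ⟩
    + (b ℕ.* m)  ≡⟨ ℤP.pos-* b m ⟩
    + b ℤ.* + m  ∎))
  where open ≡-Reasoning

/-+-/ : ∀ a b m n .{{_ : NonZero m}} .{{_ : NonZero n}} →
        + a / m + + b / n ≡ (+ (a ℕ.* n ℕ.+ b ℕ.* m) / (m ℕ.* n)) {{ℕP.m*n≢0 m n}}
/-+-/ a b m@(suc m-1) n@(suc n-1) = ℚP.toℚᵘ-injective (begin
  toℚᵘ (+ a / m + + b / n)
    ≈⟨ ℚP.toℚᵘ-homo-+ (+ a / m) (+ b / n) ⟩
  toℚᵘ (+ a / m) ℚᵘ.+ toℚᵘ (+ b / n)
    ≈⟨ ℚᵘP.+-cong (ℚP.toℚᵘ-fromℚᵘ (ℚᵘ.mkℚᵘ (+ a) m-1)) (ℚP.toℚᵘ-fromℚᵘ (ℚᵘ.mkℚᵘ (+ b) n-1)) ⟩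
  ℚᵘ.mkℚᵘ (+ a) m-1 ℚᵘ.+ ℚᵘ.mkℚᵘ (+ b) n-1
    ≡⟨ cong (λ z → ℚᵘ.mkℚᵘ z (ℕ.pred (m ℕ.* n))) numerator ⟩
  ℚᵘ.mkℚᵘ (+ (a ℕ.* n ℕ.+ b ℕ.* m)) (ℕ.pred (m ℕ.* n))
    ≈⟨ ℚP.toℚᵘ-fromℚᵘ (ℚᵘ.mkℚᵘ (+ (a ℕ.* n ℕ.+ b ℕ.* m)) (ℕ.pred (m ℕ.* n))) ⟨
  toℚᵘ (+ (a ℕ.* n ℕ.+ b ℕ.* m) / (m ℕ.* n)) ∎)
  where
  open ℚᵘP.≃-Reasoning
  numerator : + a ℤ.* + n ℤ.+ + b ℤ.* + m ≡ + (a ℕ.* n ℕ.+ b ℕ.* m)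
  numerator = trans (cong₂ ℤ._+_ (sym (ℤP.pos-* a n)) (sym (ℤP.pos-* b m))) (sym (ℤP.pos-+ (a ℕ.* n) (b ℕ.* m)))

·-/ : ∀ n a m .{{_ : NonZero m}} → n · (+ a / m) ≡ + (n ℕ.* a) / m
·-/ zero    a m = sym (ℚP.0/n≡0 m)
·-/ (suc n) a m = begin
  + a / m + n · (+ a / m)
    ≡⟨ cong (_+_ (+ a / m)) (·-/ n a m) ⟩
  + a / m + + (n ℕ.* a) / m
    ≡⟨ /-+-/ a (n ℕ.* a) m m ⟩
  + (a ℕ.* m ℕ.+ n ℕ.* a ℕ.* m) / (m ℕ.* m)
    ≡⟨ /-cross (a ℕ.* m ℕ.+ n ℕ.* a ℕ.* m) (suc n ℕ.* a) (m ℕ.* m) m (cancel a n m) ⟩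
  + (suc n ℕ.* a) / m ∎
  where
  open ≡-Reasoning
  open +-*-Solver
  instance
    m*m≢0 : NonZero (m ℕ.* m)
    m*m≢0 = ℕP.m*n≢0 m m
  cancel : ∀ a n m → (a ℕ.* m ℕ.+ n ℕ.* a ℕ.* m) ℕ.* m ≡ (a ℕ.+ n ℕ.* a) ℕ.* (m ℕ.* m)
  cancel = solve 3 (λ a n m → (a :* m :+ n :* a :* m) :* m := (a :+ n :* a) :* (m :* m)) refl

0≤1/ : ∀ n .{{_ : NonZero n}} → 0ℚ ≤ + 1 / n
0≤1/ n = ℚP.nonNegative⁻¹ (+ 1 / n) {{ℚP.normalize-nonNeg 1 n}}

sumℚ-++ : ∀ xs ys → sumℚ (xs ++ ys) ≡ sumℚ xs + sumℚ ys
sumℚ-++ []       ys = sym (ℚP.+-identityˡ (sumℚ ys))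
sumℚ-++ (x ∷ xs) ys = trans (cong (_+_ x) (sumℚ-++ xs ys)) (sym (ℚP.+-assoc x (sumℚ xs) (sumℚ ys)))

sumℚ-map-const : ∀ {A : Set} (h : A → ℚ) xs {c} → (∀ x → h x ≡ c) → sumℚ (List.map h xs) ≡ length xs · c
sumℚ-map-const h []       h≡c = refl
sumℚ-map-const h (x ∷ xs) h≡c = cong₂ _+_ (h≡c x) (sumℚ-map-const h xs h≡c)

length-concatMap-const : ∀ {A B : Set} (g : A → List B) xs {c} → (∀ x → length (g x) ≡ c) →
                         length (concatMap g xs) ≡ length xs ℕ.* c
length-concatMap-const g []       len≡c = refl
length-concatMap-const g (x ∷ xs) len≡c =
  trans (ListP.length-++ (g x)) (cong₂ ℕ._+_ (len≡c x) (length-concatMap-const g xs len≡c))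

length-allVecs : ∀ k n → length (allVecs k n) ≡ k ℕ.^ n
length-allVecs k zero    = refl
length-allVecs k (suc n) = begin
  length (allVecs k (suc n))
    ≡⟨ length-concatMap-const _ (allFin k) (λ _ → trans (ListP.length-map _ (allVecs k n)) (length-allVecs k n)) ⟩
  length (allFin k) ℕ.* k ℕ.^ n
    ≡⟨ cong (ℕ._* k ℕ.^ n) (ListP.length-tabulate {n = k} (λ i → i)) ⟩
  k ℕ.* k ℕ.^ n ∎
  where open ≡-Reasoning

length-allFuns : ∀ {A : Set} m (xs : List A) → length (allFuns m xs) ≡ length xs ℕ.^ m
length-allFuns zero    xs = refl
length-allFuns (suc m) xs =
  length-concatMap-const _ xs (λ _ → trans (ListP.length-map _ (allFuns m xs)) (length-allFuns m xs))

totalWeight : ∀ {V k} → Instance V k → ℚ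
totalWeight I = sumℚ (List.map proj₁ I)

totalWeight-concatMap : ∀ {A V : Set} {k} (g : A → Instance V k) xs →
                        totalWeight (concatMap g xs) ≡ sumℚ (List.map (totalWeight ∘ g) xs)
totalWeight-concatMap g []       = refl
totalWeight-concatMap g (x ∷ xs) = begin
  sumℚ (List.map proj₁ (g x ++ concatMap g xs))
    ≡⟨ cong sumℚ (ListP.map-++ proj₁ (g x) (concatMap g xs)) ⟩
  sumℚ (List.map proj₁ (g x) ++ List.map proj₁ (concatMap g xs))
    ≡⟨ sumℚ-++ (List.map proj₁ (g x)) (List.map proj₁ (concatMap g xs)) ⟩
  totalWeight (g x) + totalWeight (concatMap g xs)
    ≡⟨ cong (_+_ (totalWeight (g x))) (totalWeight-concatMap g xs) ⟩
  sumℚ (List.map (totalWeight ∘ g) (x ∷ xs)) ∎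
  where open ≡-Reasoning

totalWeight-grid : ∀ {A B V : Set} {k} (xs : List A) (ys : List B) w (y : A → B → Fin k → V) →
                   totalWeight (concatMap (λ a → List.map (λ b → w , y a b) ys) xs) ≡ length xs · (length ys · w)
totalWeight-grid xs ys w y = trans (totalWeight-concatMap _ xs) (sumℚ-map-const _ xs row)
  where
  row : ∀ a → totalWeight (List.map (λ b → w , y a b) ys) ≡ length ys · w
  row a = trans (cong sumℚ (sym (ListP.map-∘ ys))) (sumℚ-map-const _ ys (λ _ → refl))

value≤totalWeight : ∀ {V k} (f : PayoffFn k) (sol : Solution V) (I : Instance V k) →
                    All (λ { (w , y) → 0ℚ ≤ w × payoff f sol y ≤ 1ℚ }) I → value f I sol ≤ totalWeight I
value≤totalWeight f sol []            []                 = ℚP.≤-refl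
value≤totalWeight f sol ((w , y) ∷ I) ((0≤w , p≤1) ∷ ok) = ℚP.+-mono-≤ w*p≤w (value≤totalWeight f sol I ok)
  where
  w*p≤w : w * payoff f sol y ≤ w
  w*p≤w = ℚP.≤-trans (ℚP.*-monoˡ-≤-nonNeg w {{nonNegative 0≤w}} p≤1) (ℚP.≤-reflexive (ℚP.*-identityʳ w))

value≡totalWeight : ∀ {V k} (f : PayoffFn k) (sol : Solution V) (I : Instance V k) →
                    All (λ { (w , y) → payoff f sol y ≡ 1ℚ }) I → value f I sol ≡ totalWeight I
value≡totalWeight f sol []            []         = refl
value≡totalWeight f sol ((w , y) ∷ I) (p≡1 ∷ ok) =
  cong₂ _+_ (trans (cong (w *_) p≡1) (ℚP.*-identityʳ w)) (value≡totalWeight f sol I ok)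

-- The gap instance

module GapInstance (k d : ℕ) .{{_ : NonZero k}} .{{_ : NonZero d}} where

  denominator : ℕ → ℕ
  denominator t = d ℕ.* (k ℕ.^ t ℕ.* (k ℕ.^ (d ∸ suc t)) ℕ.^ k)

  denominator≢0 : ∀ t → NonZero (denominator t)
  denominator≢0 t = ℕP.m*n≢0 d _
    where
    instance
      _ = ℕP.m^n≢0 k t
      _ = ℕP.m^n≢0 k (d ∸ suc t)
      _ = ℕP.m^n≢0 (k ℕ.^ (d ∸ suc t)) k
      _ = ℕP.m*n≢0 (k ℕ.^ t) ((k ℕ.^ (d ∸ suc t)) ℕ.^ k)

  -- u is the path to a node at depth t and s j the path from its j-th child down to the leaf l_j.
  gapTuple : (t : Fin d) → Vec (Fin k) (toℕ t) → (Fin k → Vec (Fin k) (d ∸ suc (toℕ t))) →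
             Fin k → Vec (Fin k) d
  gapTuple t u s j = cast (len-lemma (toℕ t) d (toℕ<n t)) (u Vec.++ j ∷ s j)

  level : Fin d → Instance (Vec (Fin k) d) k
  level t = concatMap (λ u → List.map (λ s → weight k d (toℕ t) , gapTuple t u s)
                                      (allFuns k (allVecs k (d ∸ suc (toℕ t)))))
                      (allVecs k (toℕ t))

  All-gapInstance : {Q : ℚ × (Fin k → Vec (Fin k) d) → Set} →
                    (∀ t u s → Q (weight k d (toℕ t) , gapTuple t u s)) → All Q (gapInstance k d)
  All-gapInstance Q-gap = AllP.concat⁺ (AllP.map⁺ (All.universal (λ t →
    AllP.concat⁺ (AllP.map⁺ (All.universal (λ u →
      AllP.map⁺ (All.universal (Q-gap t u) (allFuns k (allVecs k (d ∸ suc (toℕ t))))))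
      (allVecs k (toℕ t)))))
    (allFin d)))

  gapTuple-injective : ∀ t u s → Injective _≡_ _≡_ (gapTuple t u s)
  gapTuple-injective t u s eq =
    VecP.∷-injectiveˡ (VecP.++-injectiveʳ u u (cast-injective (len-lemma (toℕ t) d (toℕ<n t)) eq))
    where
    cast-injective : ∀ {n n′} (n≡n′ : n ≡ n′) {v w : Vec (Fin k) n} →
                     cast n≡n′ v ≡ cast n≡n′ w → v ≡ w
    cast-injective refl {v} {w} eq′ = trans (sym (VecP.cast-is-id refl v)) (trans eq′ (VecP.cast-is-id refl w))

  0≤weight : ∀ t → 0ℚ ≤ weight k d t
  0≤weight t = 0≤1/ (denominator t) {{denominator≢0 t}}

  totalWeight-level : ∀ t → totalWeight (level t) ≡ + 1 / d
  totalWeight-level t = begin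
    totalWeight (level t)
      ≡⟨ totalWeight-grid (allVecs k (toℕ t)) subtrees (weight k d (toℕ t)) (gapTuple t) ⟩
    length (allVecs k (toℕ t)) · (length subtrees · weight k d (toℕ t))
      ≡⟨ cong₂ (λ a b → a · (b · weight k d (toℕ t))) (length-allVecs k (toℕ t)) subtreeCount ⟩
    A · (B · (+ 1 / N))     ≡⟨ cong (A ·_) (·-/ B 1 N) ⟩
    A · (+ (B ℕ.* 1) / N)   ≡⟨ ·-/ A (B ℕ.* 1) N ⟩
    + (A ℕ.* (B ℕ.* 1)) / N ≡⟨ /-cross (A ℕ.* (B ℕ.* 1)) 1 N d (count A B d) ⟩
    + 1 / d                 ∎
    where
    open ≡-Reasoning
    open +-*-Solver
    subtrees = allFuns k (allVecs k (d ∸ suc (toℕ t)))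
    A = k ℕ.^ toℕ t
    B = (k ℕ.^ (d ∸ suc (toℕ t))) ℕ.^ k
    N = denominator (toℕ t)
    instance _ = denominator≢0 (toℕ t)
    subtreeCount : length subtrees ≡ B
    subtreeCount = trans (length-allFuns k _) (cong (ℕ._^ k) (length-allVecs k (d ∸ suc (toℕ t))))
    count : ∀ A B D → A ℕ.* (B ℕ.* 1) ℕ.* D ≡ 1 ℕ.* (D ℕ.* (A ℕ.* B))
    count = solve 3 (λ A B D → A :* (B :* con 1) :* D := con 1 :* (D :* (A :* B))) refl

  totalWeight-gapInstance : totalWeight (gapInstance k d) ≡ 1ℚ
  totalWeight-gapInstance = begin
    totalWeight (gapInstance k d)                    ≡⟨ totalWeight-concatMap level (allFin d) ⟩
    sumℚ (List.map (totalWeight ∘ level) (allFin d)) ≡⟨ sumℚ-map-const _ (allFin d) totalWeight-level ⟩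
    length (allFin d) · (+ 1 / d)                    ≡⟨ cong (_· (+ 1 / d)) (ListP.length-tabulate {n = d} _) ⟩
    d · (+ 1 / d)                                    ≡⟨ ·-/ d 1 d ⟩
    + (d ℕ.* 1) / d                                  ≡⟨ /-cross (d ℕ.* 1) 1 d 1 d*1*1≡1*d ⟩
    1ℚ                                               ∎
    where
    open ≡-Reasoning
    d*1*1≡1*d : d ℕ.* 1 ℕ.* 1 ≡ 1 ℕ.* d
    d*1*1≡1*d = trans (ℕP.*-identityʳ (d ℕ.* 1)) (trans (ℕP.*-identityʳ d) (sym (ℕP.*-identityˡ d)))

lemma2 : (k : ℕ) .{{_ : NonZero k}} (f : PayoffFn k) → IsPayoff f → Satisfiable f →
         (d : ℕ) .{{_ : NonZero d}} → OptIs f (gapInstance k d) 1ℚ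
lemma2 k f isPayoff (P , isP , fP≡1) d = (solution , value≡1) , value≤1
  where
  open GapInstance k d
  open GraftPower P isP

  solution : Solution (Vec (Fin k) d)
  solution = graftPower d , embed , embed-injective

  matched-gapTuple : ∀ t u s → matched solution (gapTuple t u s) ≡ just P
  matched-gapTuple t u s = trans (prune-embed-cast (len-lemma (toℕ t) d (toℕ<n t)) _) (prune-branch u s)

  value≡1 : value f (gapInstance k d) solution ≡ 1ℚ
  value≡1 = trans
    (value≡totalWeight f solution _
      (All-gapInstance λ t u s → trans (cong (maybe f 0ℚ) (matched-gapTuple t u s)) fP≡1))
    totalWeight-gapInstance

  value≤1 : ∀ sol → value f (gapInstance k d) sol ≤ 1ℚ
  value≤1 sol = subst (value f (gapInstance k d) sol ≤_) totalWeight-gapInstance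
    (value≤totalWeight f sol _
      (All-gapInstance λ t u s → 0≤weight (toℕ t) , payoff≤1 f isPayoff sol (gapTuple-injective t u s)))
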